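{- Let $n>1$. For every set composition $F\in\Sigma_n$ we have $n_{(1,n-1)}(F)=\operatorname{sin}F$ and $\widetilde{n}_{(1,n-1)}(F)=(-1)^{n-\ell(F)}\operatorname{sin}F$, where $\operatorname{sin}F$ is the number of blocks of $F$ of size $1$.
   Context: A set composition of $[n]=\{1,\ldots,n\}$ is a tuple $F=(F_1,\ldots,F_k)$ of nonempty, pairwise disjoint subsets of $[n]$ whose union is $[n]$; its length is $\ell(F)=k$ and its type is $(|F_1|,\ldots,|F_k|)$. $\Sigma_n$ is the set of all set compositions of $[n]$. For $F,G\in\Sigma_n$, $F\preceq G$ means every block of $F$ is a subset of some block of $G$. For a composition $\alpha$ of $n$, $n_\alpha(F)=\#\{G\in\Sigma_n: F\preceq G,\ \operatorname{type}G=\alpha\}$ and $\widetilde{n}_\alpha(F)=(-1)^{n-\ell(F)}n_\alpha(F)$. -}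

module Defs where

open import Data.Nat using (ℕ; _∸_; _≟_)
open import Data.Integer using (ℤ; +_; _*_; -_; _^_)
open import Data.Fin using (Fin)
open import Data.Fin.Subset using (Subset; _∈_; _⊆_; _∩_; ∣_∣; Nonempty; Empty)
open import Data.List using (List; []; _∷_; length; map; filter)
open import Data.List.Relation.Unary.All using (All)
open import Data.List.Relation.Unary.Any using (Any)
open import Data.List.Relation.Unary.AllPairs using (AllPairs)
open import Data.Product using (Σ; _×_)
open import Data.Refinement using (Refinement)
open import Function.Bundles using (_↔_)
open import Relation.Binary.PropositionalEquality using (_≡_)

-- The side conditions are proof-irrelevant, so two set compositions are equal
-- iff their block lists are equal.
record SetComp (n : ℕ) : Set where
  constructor setComp
  field
    blocks    : List (Subset n)
    .nonempty : All Nonempty blocks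
    .disjoint : AllPairs (λ A B → Empty (A ∩ B)) blocks
    .cover    : ∀ (i : Fin n) → Any (i ∈_) blocks
open SetComp public

ℓ : ∀ {n} → SetComp n → ℕ
ℓ F = length (blocks F)

type : ∀ {n} → SetComp n → List ℕ
type F = map ∣_∣ (blocks F)

_⪯_ : ∀ {n} → SetComp n → SetComp n → Set
F ⪯ G = All (λ B → Any (B ⊆_) (blocks G)) (blocks F)

_HasCard_ : Set → ℕ → Set
A HasCard k = Fin k ↔ A

Above : ∀ {n} → List ℕ → SetComp n → Set
Above {n} α F = Refinement (SetComp n) (λ G → (F ⪯ G) × (type G ≡ α))

NCount : ∀ {n} → List ℕ → SetComp n → ℕ → Set
NCount α F k = Above α F HasCard k

NTilde : ∀ {n} → List ℕ → SetComp n → ℤ → Set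
NTilde {n} α F z = Σ ℕ (λ k → NCount α F k × (z ≡ ((- (+ 1)) ^ (n ∸ ℓ F)) * (+ k)))

sin : ∀ {n} → SetComp n → ℕ
sin F = length (filter (λ B → ∣ B ∣ ≟ 1) (blocks F))

{-# OPTIONS --safe #-}
module Submission where

-- A coarsening G of F of type (1, n-1) is ({i}, [n] ∖ {i}), and {i} is already a block of F:
-- the block of F containing i lies in a block of G meeting {i}, hence in {i}. Conversely each
-- singleton block {i} of F gives such a G (here n > 1 makes [n] ∖ {i} nonempty). So G ↦ first
-- block of G is a bijection onto the singleton blocks of F, which are distinct because blocks
-- are disjoint and nonempty.

open import Defs
open import Data.Bool.Properties using () renaming (_≟_ to _≟ᵇ_)
open import Data.Fin using (Fin; zero; suc)
open import Data.Fin.Properties using () renaming (_≟_ to _≟ᶠ_)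
open import Data.Fin.Subset using (Subset; _∈_; _⊆_; _∩_; ∁; ∣_∣; ⊥; ⁅_⁆; Nonempty; Empty)
open import Data.Fin.Subset.Properties
open import Data.Integer using (+_; _*_; -_; _^_)
open import Data.Irrelevant using ([_])
open import Data.List using (List; []; _∷_; length; map; filter; lookup)
open import Data.List.Properties using (∷-injectiveˡ)
open import Data.List.Membership.Propositional using (find) renaming (_∈_ to _∈ₗ_)
open import Data.List.Membership.Propositional.Properties using (∈-lookup; ∈-filter⁺; ∈-filter⁻)
open import Data.List.Relation.Unary.All as All using (All; []; _∷_)
open import Data.List.Relation.Unary.AllPairs as AllPairs using (AllPairs; []; _∷_)
open import Data.List.Relation.Unary.Any using (Any; here; there; index)
open import Data.List.Relation.Unary.Any.Properties using (lookup-index)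
open import Data.List.Relation.Unary.Unique.Propositional using (Unique)
import Data.List.Relation.Unary.Unique.Propositional.Properties as Unique
open import Data.Nat using (ℕ; _≤_; _<_; _∸_; _≟_)
open import Data.Nat.Properties using (≤-refl; <⇒≱; m<n⇒0<n∸m)
open import Data.Product using (_×_; _,_; proj₁; proj₂)
open import Data.Refinement using (_,_; value; value-injective)
open import Data.Vec.Properties using () renaming (≡-dec to Vec-≡-dec)
open import Function.Base using (_∘_)
open import Function.Bundles using (_↔_; mk↔ₛ′)
open import Level using (0ℓ)
open import Relation.Binary.Core using (Rel)
open import Relation.Binary.Definitions using (Symmetric; DecidableEquality)
open import Relation.Binary.PropositionalEquality using (_≡_; _≢_; refl; sym; trans; cong; cong₂; subst)
open import Relation.Nullary using (Dec; yes; no; contradiction)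
open import Relation.Nullary.Decidable using (recompute)

AllPairs-distinct⇒R : ∀ {A : Set} {R : Rel A 0ℓ} {xs : List A} {x y : A} →
  Symmetric R → AllPairs R xs → x ∈ₗ xs → y ∈ₗ xs → x ≢ y → R x y
AllPairs-distinct⇒R R-sym (_  ∷ _)  (here refl) (here refl) x≢y = contradiction refl x≢y
AllPairs-distinct⇒R R-sym (Rx ∷ _)  (here refl) (there y∈)  x≢y = All.lookup Rx y∈
AllPairs-distinct⇒R R-sym (Ry ∷ _)  (there x∈)  (here refl) x≢y = R-sym (All.lookup Ry x∈)
AllPairs-distinct⇒R R-sym (_  ∷ Rs) (there x∈)  (there y∈)  x≢y = AllPairs-distinct⇒R R-sym Rs x∈ y∈ x≢y

lookup-injective : ∀ {A : Set} {xs : List A} → Unique xs →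
  (i j : Fin (length xs)) → lookup xs i ≡ lookup xs j → i ≡ j
lookup-injective (x∉ ∷ u) zero    zero    eq = refl
lookup-injective (x∉ ∷ u) zero    (suc j) eq = contradiction eq (All.lookup x∉ (∈-lookup j))
lookup-injective (x∉ ∷ u) (suc i) zero    eq = contradiction (sym eq) (All.lookup x∉ (∈-lookup i))
lookup-injective (x∉ ∷ u) (suc i) (suc j) eq = cong suc (lookup-injective u i j eq)

module _ {n : ℕ} where

  _≟ˢ_ : DecidableEquality (Subset n)
  _≟ˢ_ = Vec-≡-dec _≟ᵇ_

  open import Data.List.Membership.DecPropositional _≟ˢ_ using () renaming (_∈?_ to _∈ₗ?_)

  Disjoint : Rel (Subset n) 0ℓ
  Disjoint p q = Empty (p ∩ q)

  Disjoint-sym : Symmetric Disjoint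
  Disjoint-sym {p} {q} p∩q=∅ = p∩q=∅ ∘ subst Nonempty (∩-comm q p)

  Disjoint-∁ : (p : Subset n) → Disjoint p (∁ p)
  Disjoint-∁ p (x , x∈) = ∉⊥ (subst (x ∈_) (∩-inverseʳ p) x∈)

  Disjoint⇒⊆∁ : ∀ {p q} → Disjoint p q → p ⊆ ∁ q
  Disjoint⇒⊆∁ {p} {q} p∩q=∅ {x} x∈p with x ∈? q
  ... | yes x∈q = contradiction (x , x∈p∩q⁺ (x∈p , x∈q)) p∩q=∅
  ... | no  x∉q = x∉p⇒x∈∁p x∉q

  Disjoint∧Nonempty⇒≢ : ∀ {p q} → Disjoint p q → Nonempty p → p ≢ q
  Disjoint∧Nonempty⇒≢ p∩q=∅ (x , x∈p) refl = p∩q=∅ (x , x∈p∩q⁺ (x∈p , x∈p))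

  ∣p∣>0⇒Nonempty : ∀ {p : Subset n} → 0 < ∣ p ∣ → Nonempty p
  ∣p∣>0⇒Nonempty {p} ∣p∣>0 with nonempty? p
  ... | yes ne = ne
  ... | no ¬ne = contradiction (subst (0 <_) (trans (cong ∣_∣ (Empty-unique ¬ne)) (∣⊥∣≡0 n)) ∣p∣>0) λ ()

  ∣p∣≡1⇒Nonempty : ∀ {p : Subset n} → ∣ p ∣ ≡ 1 → Nonempty p
  ∣p∣≡1⇒Nonempty ∣p∣≡1 = ∣p∣>0⇒Nonempty (subst (0 <_) (sym ∣p∣≡1) ≤-refl)

  Nonempty⇒∣p∣>0 : ∀ {p : Subset n} → Nonempty p → 0 < ∣ p ∣
  Nonempty⇒∣p∣>0 {p} (x , x∈p) =
    subst (_≤ ∣ p ∣) (∣⁅x⁆∣≡1 x) (p⊆q⇒∣p∣≤∣q∣ ⁅x⁆⊆p)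
    where
    ⁅x⁆⊆p : ⁅ x ⁆ ⊆ p
    ⁅x⁆⊆p y∈⁅x⁆ = subst (_∈ p) (sym (x∈⁅y⁆⇒x≡y x y∈⁅x⁆)) x∈p

  ∣p∣<n⇒Nonempty∁ : ∀ {p : Subset n} → ∣ p ∣ < n → Nonempty (∁ p)
  ∣p∣<n⇒Nonempty∁ {p} ∣p∣<n = ∣p∣>0⇒Nonempty (subst (0 <_) (sym (∣∁p∣≡n∸∣p∣ p)) (m<n⇒0<n∸m ∣p∣<n))

  p⊆q∧∣q∣≤∣p∣⇒p≡q : ∀ {p q : Subset n} → p ⊆ q → ∣ q ∣ ≤ ∣ p ∣ → p ≡ q
  p⊆q∧∣q∣≤∣p∣⇒p≡q {p} {q} p⊆q ∣q∣≤∣p∣ = ⊆-antisym p⊆q q⊆p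
    where
    q⊆p : q ⊆ p
    q⊆p {x} x∈q with x ∈? p
    ... | yes x∈p = x∈p
    ... | no  x∉p = contradiction ∣q∣≤∣p∣ (<⇒≱ (p⊂q⇒∣p∣<∣q∣ (p⊆q , x , x∈q , x∉p)))

  Covers : List (Subset n) → Set
  Covers bs = ∀ x → Any (x ∈_) bs

  Refines : List (Subset n) → List (Subset n) → Set
  Refines bs cs = All (λ D → Any (D ⊆_) cs) bs

  Covers-∁ : (p : Subset n) → Covers (p ∷ ∁ p ∷ [])
  Covers-∁ p x with x ∈? p
  ... | yes x∈p = here x∈p
  ... | no  x∉p = there (here (x∉p⇒x∈∁p x∉p))

  ∁-unique : ∀ {p q} → Disjoint p q → Covers (p ∷ q ∷ []) → q ≡ ∁ p
  ∁-unique {p} {q} p∩q=∅ cover = ⊆-antisym (Disjoint⇒⊆∁ (Disjoint-sym p∩q=∅)) ∁p⊆q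
    where
    ∁p⊆q : ∁ p ⊆ q
    ∁p⊆q {x} x∈∁p with cover x
    ... | here x∈p         = contradiction x∈p (x∈∁p⇒x∉p x∈∁p)
    ... | there (here x∈q) = x∈q

  Disjoint∧Nonempty⇒Unique : ∀ {bs} → All Nonempty bs → AllPairs Disjoint bs → Unique bs
  Disjoint∧Nonempty⇒Unique []         []            = []
  Disjoint∧Nonempty⇒Unique (ne ∷ nes) (disj ∷ disjs) =
    All.map (λ p∩q=∅ → Disjoint∧Nonempty⇒≢ p∩q=∅ ne) disj ∷ Disjoint∧Nonempty⇒Unique nes disjs

  block⇒Refines[p,∁p] : ∀ {bs p} → AllPairs Disjoint bs → p ∈ₗ bs → Refines bs (p ∷ ∁ p ∷ [])
  block⇒Refines[p,∁p] {p = p} disjs p∈bs = All.tabulate block⊆p∨∁p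
    where
    block⊆p∨∁p : ∀ {D} → D ∈ₗ _ → Any (D ⊆_) (p ∷ ∁ p ∷ [])
    block⊆p∨∁p {D} D∈bs with D ≟ˢ p
    ... | yes refl = here ⊆-refl
    ... | no  D≢p  = there (here (Disjoint⇒⊆∁ (AllPairs-distinct⇒R Disjoint-sym disjs D∈bs p∈bs D≢p)))

  -- The finer block containing the point x of p lies in a coarser block meeting p, hence in p.
  singleton-block-of-coarser : ∀ {bs cs p} → Covers bs → AllPairs Disjoint cs → Refines bs cs →
    p ∈ₗ cs → ∣ p ∣ ≡ 1 → p ∈ₗ bs
  singleton-block-of-coarser {bs} {cs} {p} cover disjs refines p∈cs ∣p∣≡1
    with x , x∈p ← ∣p∣≡1⇒Nonempty ∣p∣≡1
    with D , D∈bs , x∈D ← find (cover x)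
    with q , q∈cs , D⊆q ← find (All.lookup refines D∈bs)
    with q ≟ˢ p
  ... | yes refl = subst (_∈ₗ bs) D≡p D∈bs
    where
    D≡p : D ≡ p
    D≡p = p⊆q∧∣q∣≤∣p∣⇒p≡q D⊆q (subst (_≤ ∣ D ∣) (sym ∣p∣≡1) (Nonempty⇒∣p∣>0 (x , x∈D)))
  ... | no q≢p = contradiction (x , x∈p∩q⁺ (D⊆q x∈D , x∈p)) (AllPairs-distinct⇒R Disjoint-sym disjs q∈cs p∈cs q≢p)

  blocks-injective : ∀ {F G : SetComp n} → blocks F ≡ blocks G → F ≡ G
  blocks-injective {setComp _ _ _ _} {setComp _ _ _ _} refl = refl

  splitOff : (p : Subset n) → .(Nonempty p) → .(Nonempty (∁ p)) → SetComp n
  splitOff p ne ne∁ = setComp (p ∷ ∁ p ∷ []) (ne ∷ ne∁ ∷ []) ((Disjoint-∁ p ∷ []) ∷ [] ∷ []) (Covers-∁ p)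

  singleton? : (p : Subset n) → Dec (∣ p ∣ ≡ 1)
  singleton? p = ∣ p ∣ ≟ 1

  singletonBlocks : SetComp n → List (Subset n)
  singletonBlocks F = filter singleton? (blocks F)

  -- ⊥ is a junk value: it is only taken on the empty set composition.
  firstBlock : SetComp n → Subset n
  firstBlock (setComp []      _ _ _) = ⊥
  firstBlock (setComp (p ∷ _) _ _ _) = p

  type≡[a,b]⇒blocks≡[p,∁p] : ∀ {a b} (G : SetComp n) → .(type G ≡ a ∷ b ∷ []) →
    blocks G ≡ firstBlock G ∷ ∁ (firstBlock G) ∷ []
  type≡[a,b]⇒blocks≡[p,∁p] (setComp []              _ _ _) ()
  type≡[a,b]⇒blocks≡[p,∁p] (setComp (_ ∷ [])        _ _ _) ()
  type≡[a,b]⇒blocks≡[p,∁p] (setComp (_ ∷ _ ∷ _ ∷ _) _ _ _) ()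
  type≡[a,b]⇒blocks≡[p,∁p] (setComp (p ∷ q ∷ [])    _ disjs cover) _ =
    cong (λ r → p ∷ r ∷ []) (recompute (q ≟ˢ ∁ p) (∁-unique (All.head (AllPairs.head disjs)) cover))

  firstBlock∈singletonBlocks : ∀ {m} (F : SetComp n) (G : Above (1 ∷ m ∷ []) F) →
    firstBlock (value G) ∈ₗ singletonBlocks F
  firstBlock∈singletonBlocks F@(setComp bs _ _ cover) (G@(setComp cs _ disjs _) , [ F⪯G×ty ]) =
    recompute (firstBlock G ∈ₗ? singletonBlocks F) (
      let shape = type≡[a,b]⇒blocks≡[p,∁p] G (proj₂ F⪯G×ty)
          ∣first∣≡1 = ∷-injectiveˡ (trans (cong (map ∣_∣) (sym shape)) (proj₂ F⪯G×ty))
          first∈cs = subst (firstBlock G ∈ₗ_) (sym shape) (here refl)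
      in ∈-filter⁺ singleton? (singleton-block-of-coarser cover disjs (proj₁ F⪯G×ty) first∈cs ∣first∣≡1) ∣first∣≡1)

  splitOff-above : 1 < n → (F : SetComp n) → ∀ {p} → p ∈ₗ singletonBlocks F → Above (1 ∷ n ∸ 1 ∷ []) F
  splitOff-above 1<n (setComp bs _ disjs _) {p} p∈ =
    splitOff p (∣p∣≡1⇒Nonempty ∣p∣≡1) (∣p∣<n⇒Nonempty∁ (subst (_< n) (sym ∣p∣≡1) 1<n)) ,
    [ block⇒Refines[p,∁p] disjs p∈bs , cong₂ (λ a b → a ∷ b ∷ []) ∣p∣≡1 ∣∁p∣≡n∸1 ]
    where
    p∈bs : p ∈ₗ bs
    p∈bs = proj₁ (∈-filter⁻ singleton? {xs = bs} p∈)
    ∣p∣≡1 : ∣ p ∣ ≡ 1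
    ∣p∣≡1 = proj₂ (∈-filter⁻ singleton? {xs = bs} p∈)
    ∣∁p∣≡n∸1 : ∣ ∁ p ∣ ≡ n ∸ 1
    ∣∁p∣≡n∸1 = trans (∣∁p∣≡n∸∣p∣ p) (cong (n ∸_) ∣p∣≡1)

  singletonBlocks↔Above : 1 < n → (F : SetComp n) → Fin (sin F) ↔ Above (1 ∷ n ∸ 1 ∷ []) F
  singletonBlocks↔Above 1<n F@(setComp bs nonempty disjs _) = mk↔ₛ′ to from to∘from from∘to
    where
    to : Fin (sin F) → Above (1 ∷ n ∸ 1 ∷ []) F
    to i = splitOff-above 1<n F (∈-lookup i)

    first∈ : (G : Above (1 ∷ n ∸ 1 ∷ []) F) → firstBlock (value G) ∈ₗ singletonBlocks F
    first∈ = firstBlock∈singletonBlocks F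

    from : Above (1 ∷ n ∸ 1 ∷ []) F → Fin (sin F)
    from G = index (first∈ G)

    to∘from : ∀ G → to (from G) ≡ G
    to∘from G@(G′ , [ F⪯G×ty ]) = value-injective (blocks-injective (trans
      (cong (λ p → p ∷ ∁ p ∷ []) (sym (lookup-index (first∈ G))))
      (sym (type≡[a,b]⇒blocks≡[p,∁p] G′ (proj₂ F⪯G×ty)))))

    from∘to : ∀ i → from (to i) ≡ i
    from∘to i = recompute (from (to i) ≟ᶠ i)
      (lookup-injective (Unique.filter⁺ singleton? (Disjoint∧Nonempty⇒Unique nonempty disjs))
        (from (to i)) i (sym (lookup-index (first∈ (to i)))))

lemma9p8 : (n : ℕ) → 1 < n → (F : SetComp n) →
    NCount (1 ∷ (n ∸ 1) ∷ []) F (sin F)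
      × NTilde (1 ∷ (n ∸ 1) ∷ []) F (((- (+ 1)) ^ (n ∸ ℓ F)) * (+ sin F))
lemma9p8 n 1<n F = sin↔Above , (sin F , sin↔Above , refl)
  where
  sin↔Above : Fin (sin F) ↔ Above (1 ∷ n ∸ 1 ∷ []) F
  sin↔Above = singletonBlocks↔Above 1<n F
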